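{- Let $a,b,p,q$ be complex numbers with $p\neq 0$, $q\neq 0$. For every non-negative integer $k$ and every integer $m$: \[ q u_r^k u_{r-1}\sum_{j=0}^k \frac{w_{m-kr-r-1+rj}}{u_r^j} = u_r^{k+1}w_{m-kr-r} - w_m\qquad (r\in\mathbb{Z},\ r\neq -1), \] \[ u_{r-1}\sum_{j=0}^k \frac{w_{m-kr-r+1+rj}}{(-qu_{r-2})^j} = \frac{w_m}{(-qu_{r-2})^k} + qu_{r-2}w_{m-(k+1)r}\qquad (r\in\mathbb{Z},\ r\neq 1), \] \[ \sum_{j=0}^k \frac{w_{m-k+r+j}}{(qu_{r-1}/u_r)^j} = \frac{u_r w_m}{(qu_{r-1}/u_r)^k} - qu_{r-1}w_{m-k-1}\qquad (r\in\mathbb{Z},\ r\neq 0). \]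
   Context: The sequence $\{w_n\}=\{w_n(a,b;p,q)\}$ is defined by $w_0=a$, $w_1=b$, $w_n=pw_{n-1}-qw_{n-2}$ for $n\ge 2$, and extended to negative indices by $w_{ -n}=(pw_{ -n+1}-w_{ -n+2})/q$, so that $w_n=pw_{n-1}-qw_{n-2}$ holds for all integers $n$. The sequence $u_n=u_n(p,q)$ is $w_n(1,p;p,q)$, i.e. $u_0=1$, $u_1=p$, $u_n=pu_{n-1}-qu_{n-2}$ for all integers $n$ (so in particular $u_{ -1}=0$). -}

module Defs where

open import Level using (Level; _⊔_) renaming (suc to lsuc)
open import Algebra.Bundles using (CommutativeRing)
open import Relation.Nullary using (¬_)
open import Relation.Binary.PropositionalEquality using (_≢_)
open import Data.Nat as ℕ using (ℕ; zero; suc)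
open import Data.Integer as ℤ using (ℤ; +_; -[1+_])
open import Data.Product using (_×_; _,_; proj₁)

record Field (c ℓ : Level) : Set (lsuc (c ⊔ ℓ)) where
  field
    commutativeRing : CommutativeRing c ℓ
  open CommutativeRing commutativeRing public
  field
    0≉1   : ¬ (0# ≈ 1#)
    inv   : (x : Carrier) → ¬ (x ≈ 0#) → Carrier
    inv-r : (x : Carrier) (nz : ¬ (x ≈ 0#)) → (x * inv x nz) ≈ 1#

module Sequences {c ℓ : Level} (F : Field c ℓ) where
  open Field F hiding (zero)

  pow : Carrier → ℕ → Carrier
  pow x zero    = 1#
  pow x (suc n) = pow x n * x

  sumTo : ℕ → (ℕ → Carrier) → Carrier
  sumTo zero    f = f zero
  sumTo (suc k) f = sumTo k f + f (suc k)

  module _ (a b p q : Carrier) (q≠0 : ¬ (q ≈ 0#)) where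
    private
      qi : Carrier
      qi = inv q q≠0

    -- wPos n = (w_n , w_{n+1})
    wPos : ℕ → Carrier × Carrier
    wPos zero = a , b
    wPos (suc n) with wPos n
    ... | x , y = y , (p * y - q * x)

    -- wNeg n = (w_{-n} , w_{-n+1}), using w_{-n} = (p w_{-n+1} - w_{-n+2}) / q
    wNeg : ℕ → Carrier × Carrier
    wNeg zero = a , b
    wNeg (suc n) with wNeg n
    ... | x , y = ((p * x - y) * qi) , x

    w : ℤ → Carrier
    w (+ n)      = proj₁ (wPos n)
    w -[1+ n ]   = proj₁ (wNeg (suc n))

  u : (p q : Carrier) → ¬ (q ≈ 0#) → ℤ → Carrier
  u p q q≠0 = w 1# p p q q≠0

  module _ (a b p q : Carrier) (q≠0 : ¬ (q ≈ 0#)) (k : ℕ) (m : ℤ) where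
    private
      W : ℤ → Carrier
      W = w a b p q q≠0
      U : ℤ → Carrier
      U = u p q q≠0
      K J : ℕ → ℤ
      K n = + n
      J n = + n

    Identity1 : Set ℓ
    Identity1 = (r : ℤ) → r ≢ ℤ.- (+ 1) → (nz : ¬ (U r ≈ 0#)) →
      (q * pow (U r) k * U (r ℤ.- + 1)
         * sumTo k (λ j → W (m ℤ.- K k ℤ.* r ℤ.- r ℤ.- + 1 ℤ.+ r ℤ.* J j)
                          * pow (inv (U r) nz) j))
      ≈ (pow (U r) (suc k) * W (m ℤ.- K k ℤ.* r ℤ.- r) - W m)

    Identity2 : Set ℓ
    Identity2 = (r : ℤ) → r ≢ + 1 → (nz : ¬ ((- (q * U (r ℤ.- + 2))) ≈ 0#)) →
      (U (r ℤ.- + 1)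
         * sumTo k (λ j → W (m ℤ.- K k ℤ.* r ℤ.- r ℤ.+ + 1 ℤ.+ r ℤ.* J j)
                          * pow (inv (- (q * U (r ℤ.- + 2))) nz) j))
      ≈ (W m * pow (inv (- (q * U (r ℤ.- + 2))) nz) k
         + q * U (r ℤ.- + 2) * W (m ℤ.- (K k ℤ.+ + 1) ℤ.* r))

    Identity3 : Set ℓ
    Identity3 = (r : ℤ) → r ≢ + 0 → (nzr : ¬ (U r ≈ 0#)) →
      (nzc : ¬ ((q * U (r ℤ.- + 1) * inv (U r) nzr) ≈ 0#)) →
      sumTo k (λ j → W (m ℤ.- K k ℤ.+ r ℤ.+ J j)
                     * pow (inv (q * U (r ℤ.- + 1) * inv (U r) nzr) nzc) j)
      ≈ (U r * W m * pow (inv (q * U (r ℤ.- + 1) * inv (U r) nzr) nzc) k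
         - q * U (r ℤ.- + 1) * W (m ℤ.- K k ℤ.- + 1))

{-# OPTIONS --safe #-}
module Submission where

-- The key fact is the addition law w (n + r) = u r · w n − q · u (r − 1) · w (n − 1):
-- in r both sides solve the recurrence and they agree at r = 0 and r = 1, and a
-- solution is determined by two consecutive values (going backwards uses q ≠ 0).
-- With it, each summand of the three identities becomes (A (j+1) − c · A j) · dʲ
-- for a subsequence A of w along an arithmetic progression and c · d = 1, so the
-- sums telescope.

open import Defs
open import Level using (Level)
open import Algebra.Bundles using (CommutativeRing)
open import Relation.Nullary using (¬_; yes; no)
open import Data.Nat as ℕ using (ℕ; zero; suc)
import Data.Nat.Properties as ℕP
open import Data.Integer as ℤ using (ℤ; +_; -[1+_]; 1ℤ; _⊖_)
import Data.Integer.Properties as ℤP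
open import Data.Integer.Tactic.RingSolver using (solve-∀)
open import Data.Sign as Sign using (Sign)
open import Data.Maybe using (Maybe; just; nothing)
open import Data.Product using (_×_; _,_; proj₁)
open import Relation.Binary.PropositionalEquality as P using (_≡_)

-- The stdlib ring solver needs a coefficient ring with a homomorphism into
-- the target; for a ring with negation this is ℤ and its canonical image.
module IntegerCoefficientSolver {c ℓ : Level} (R : CommutativeRing c ℓ) where
  open CommutativeRing R
  open import Algebra.Properties.Ring ring using (-1*x≈-x; -‿involutive)
  open import Algebra.Properties.AbelianGroup +-abelianGroup using (⁻¹-∙-comm)
  open import Algebra.Properties.Group +-group using (ε⁻¹≈ε)
  open import Algebra.Properties.Semiring.Mult semiring using (×-homo-+; ×1-homo-*) renaming (_×_ to _×ᵤ_)
  open import Algebra.Properties.CommutativeSemigroup *-commutativeSemigroup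
    using () renaming (interchange to *-interchange)
  open import Algebra.Solver.Ring.AlmostCommutativeRing
  open import Relation.Binary.Reasoning.Setoid setoid

  fromℤ : ℤ → Carrier
  fromℤ (+ n)    = n ×ᵤ 1#
  fromℤ -[1+ n ] = - (suc n ×ᵤ 1#)

  x+a-[x+b]≈a-b : ∀ x a b → (x + a) - (x + b) ≈ a - b
  x+a-[x+b]≈a-b x a b = begin
    (x + a) + - (x + b)    ≈⟨ +-congˡ (sym (⁻¹-∙-comm x b)) ⟩
    (x + a) + (- x + - b)  ≈⟨ +-congʳ (+-comm x a) ⟩
    (a + x) + (- x + - b)  ≈⟨ +-assoc a x _ ⟩
    a + (x + (- x + - b))  ≈⟨ +-congˡ (sym (+-assoc x (- x) (- b))) ⟩
    a + ((x - x) + - b)    ≈⟨ +-congˡ (+-congʳ (-‿inverseʳ x)) ⟩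
    a + (0# + - b)         ≈⟨ +-congˡ (+-identityˡ _) ⟩
    a - b                  ∎

  fromℤ-⊖ : ∀ m n → fromℤ (m ⊖ n) ≈ m ×ᵤ 1# - n ×ᵤ 1#
  fromℤ-⊖ zero    zero    = sym (-‿inverseʳ 0#)
  fromℤ-⊖ (suc m) zero    = sym (trans (+-congˡ ε⁻¹≈ε) (+-identityʳ _))
  fromℤ-⊖ zero    (suc n) = sym (+-identityˡ _)
  fromℤ-⊖ (suc m) (suc n) = begin
    fromℤ (suc m ⊖ suc n)      ≡⟨ P.cong fromℤ (ℤP.[1+m]⊖[1+n]≡m⊖n m n) ⟩
    fromℤ (m ⊖ n)              ≈⟨ fromℤ-⊖ m n ⟩
    m ×ᵤ 1# - n ×ᵤ 1#          ≈⟨ sym (x+a-[x+b]≈a-b 1# _ _) ⟩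
    suc m ×ᵤ 1# - suc n ×ᵤ 1#  ∎

  fromℤ-+ : ∀ i j → fromℤ (i ℤ.+ j) ≈ fromℤ i + fromℤ j
  fromℤ-+ -[1+ m ] -[1+ n ] = begin
    - (suc (suc (m ℕ.+ n)) ×ᵤ 1#)      ≡⟨ P.cong (λ k → - (suc k ×ᵤ 1#)) (P.sym (ℕP.+-suc m n)) ⟩
    - ((suc m ℕ.+ suc n) ×ᵤ 1#)        ≈⟨ -‿cong (×-homo-+ 1# (suc m) (suc n)) ⟩
    - (suc m ×ᵤ 1# + suc n ×ᵤ 1#)      ≈⟨ sym (⁻¹-∙-comm _ _) ⟩
    - (suc m ×ᵤ 1#) + - (suc n ×ᵤ 1#)  ∎
  fromℤ-+ -[1+ m ] (+ n)    = trans (fromℤ-⊖ n (suc m)) (+-comm _ _)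
  fromℤ-+ (+ m)    -[1+ n ] = fromℤ-⊖ m (suc n)
  fromℤ-+ (+ m)    (+ n)    = ×-homo-+ 1# m n

  fromℤ-neg : ∀ i → fromℤ (ℤ.- i) ≈ - fromℤ i
  fromℤ-neg -[1+ n ]  = sym (-‿involutive _)
  fromℤ-neg (+ zero)  = sym ε⁻¹≈ε
  fromℤ-neg (+ suc n) = refl

  fromSign : Sign → Carrier
  fromSign Sign.+ = 1#
  fromSign Sign.- = - 1#

  fromSign-* : ∀ s t → fromSign (s Sign.* t) ≈ fromSign s * fromSign t
  fromSign-* Sign.+ Sign.+ = sym (*-identityˡ _)
  fromSign-* Sign.+ Sign.- = sym (*-identityˡ _)
  fromSign-* Sign.- Sign.+ = sym (*-identityʳ _)
  fromSign-* Sign.- Sign.- = sym (trans (-1*x≈-x _) (-‿involutive _))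

  fromℤ-◃ : ∀ s n → fromℤ (s ℤ.◃ n) ≈ fromSign s * (n ×ᵤ 1#)
  fromℤ-◃ s      zero    = sym (zeroʳ _)
  fromℤ-◃ Sign.+ (suc n) = sym (*-identityˡ _)
  fromℤ-◃ Sign.- (suc n) = sym (-1*x≈-x _)

  fromℤ-sign-abs : ∀ i → fromℤ i ≈ fromSign (ℤ.sign i) * (ℤ.∣ i ∣ ×ᵤ 1#)
  fromℤ-sign-abs (+ n)    = sym (*-identityˡ _)
  fromℤ-sign-abs -[1+ n ] = sym (-1*x≈-x _)

  fromℤ-* : ∀ i j → fromℤ (i ℤ.* j) ≈ fromℤ i * fromℤ j
  fromℤ-* i j = begin
    fromℤ (i ℤ.* j)
      ≈⟨ fromℤ-◃ (ℤ.sign i Sign.* ℤ.sign j) (ℤ.∣ i ∣ ℕ.* ℤ.∣ j ∣) ⟩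
    fromSign (ℤ.sign i Sign.* ℤ.sign j) * ((ℤ.∣ i ∣ ℕ.* ℤ.∣ j ∣) ×ᵤ 1#)
      ≈⟨ *-cong (fromSign-* (ℤ.sign i) (ℤ.sign j)) (×1-homo-* ℤ.∣ i ∣ ℤ.∣ j ∣) ⟩
    (fromSign (ℤ.sign i) * fromSign (ℤ.sign j)) * ((ℤ.∣ i ∣ ×ᵤ 1#) * (ℤ.∣ j ∣ ×ᵤ 1#))
      ≈⟨ *-interchange _ _ _ _ ⟩
    (fromSign (ℤ.sign i) * (ℤ.∣ i ∣ ×ᵤ 1#)) * (fromSign (ℤ.sign j) * (ℤ.∣ j ∣ ×ᵤ 1#))
      ≈⟨ sym (*-cong (fromℤ-sign-abs i) (fromℤ-sign-abs j)) ⟩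
    fromℤ i * fromℤ j  ∎

  fromℤ-homomorphism : ℤ.+-*-rawRing -Raw-AlmostCommutative⟶ fromCommutativeRing R
  fromℤ-homomorphism = record
    { ⟦_⟧ = fromℤ ; +-homo = fromℤ-+ ; *-homo = fromℤ-* ; -‿homo = fromℤ-neg
    ; 0-homo = refl ; 1-homo = +-identityʳ 1# }

  fromℤ-≈-if-≡ : ∀ i j → Maybe (fromℤ i ≈ fromℤ j)
  fromℤ-≈-if-≡ i j with i ℤ.≟ j
  ... | yes P.refl = just refl
  ... | no _       = nothing

  open import Algebra.Solver.Ring ℤ.+-*-rawRing (fromCommutativeRing R)
    fromℤ-homomorphism fromℤ-≈-if-≡ public

module _ {f ℓ : Level} (F : Field f ℓ) where
  open Field F hiding (zero)
  open Sequences F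
  open IntegerCoefficientSolver commutativeRing using (solve; _:=_; _:+_; _:*_; _:-_; :-_)
  open import Algebra.Properties.Ring ring using (-0#≈0#)
  open import Algebra.Properties.CommutativeSemigroup *-commutativeSemigroup
    using () renaming (interchange to *-interchange)
  open import Relation.Binary.Reasoning.Setoid setoid

  *-cancelˡ-≉0 : ∀ {x y z} → ¬ (x ≈ 0#) → x * y ≈ x * z → y ≈ z
  *-cancelˡ-≉0 {x} {y} {z} x≉0 xy≈xz = begin
    y                        ≈⟨ sym (*-identityˡ y) ⟩
    1# * y                   ≈⟨ *-congʳ (sym (inv-r x x≉0)) ⟩
    (x * inv x x≉0) * y      ≈⟨ regroup x _ y ⟩
    inv x x≉0 * (x * y)      ≈⟨ *-congˡ xy≈xz ⟩
    inv x x≉0 * (x * z)      ≈⟨ sym (regroup x _ z) ⟩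
    (x * inv x x≉0) * z      ≈⟨ *-congʳ (inv-r x x≉0) ⟩
    1# * z                   ≈⟨ *-identityˡ z ⟩
    z                        ∎
    where
    regroup : ∀ x i y → (x * i) * y ≈ i * (x * y)
    regroup = solve 3 (λ x i y → (x :* i) :* y := i :* (x :* y)) refl

  pow-inverse : ∀ {x y} → x * y ≈ 1# → ∀ k → pow x k * pow y k ≈ 1#
  pow-inverse {x} {y} xy≈1 zero    = *-identityʳ 1#
  pow-inverse {x} {y} xy≈1 (suc k) = begin
    (pow x k * x) * (pow y k * y)  ≈⟨ *-interchange (pow x k) x (pow y k) y ⟩
    (pow x k * pow y k) * (x * y)  ≈⟨ *-cong (pow-inverse xy≈1 k) xy≈1 ⟩
    1# * 1#                        ≈⟨ *-identityʳ 1# ⟩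
    1#                             ∎

  x-[x-y]≈y : ∀ x y → x - (x - y) ≈ y
  x-[x-y]≈y = solve 2 (λ x y → x :- (x :- y) := y) refl

  sumTo-cong : ∀ k {f g : ℕ → Carrier} → (∀ j → f j ≈ g j) → sumTo k f ≈ sumTo k g
  sumTo-cong zero    f≈g = f≈g zero
  sumTo-cong (suc k) f≈g = +-cong (sumTo-cong k f≈g) (f≈g (suc k))

  sumTo-*ˡ : ∀ k x (f : ℕ → Carrier) → x * sumTo k f ≈ sumTo k (λ j → x * f j)
  sumTo-*ˡ zero    x f = refl
  sumTo-*ˡ (suc k) x f = trans (distribˡ x _ _) (+-congʳ (sumTo-*ˡ k x f))

  telescope : ∀ (A T : ℕ → Carrier) {c d} → c * d ≈ 1# →
              (∀ j → T j ≈ A (suc j) - c * A j) →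
              ∀ k → sumTo k (λ j → T j * pow d j) ≈ A (suc k) * pow d k - c * A 0
  telescope A T {c} {d} cd≈1 T≈ zero = begin
    T 0 * 1#                   ≈⟨ *-identityʳ _ ⟩
    T 0                        ≈⟨ T≈ 0 ⟩
    A 1 - c * A 0              ≈⟨ +-congʳ (sym (*-identityʳ _)) ⟩
    A 1 * 1# - c * A 0         ∎
  telescope A T {c} {d} cd≈1 T≈ (suc k) = begin
    sumTo k (λ j → T j * pow d j) + T (suc k) * (pow d k * d)
      ≈⟨ +-cong (telescope A T cd≈1 T≈ k) (*-congʳ (T≈ (suc k))) ⟩
    (A (suc k) * pow d k - c * A 0) + (A (suc (suc k)) - c * A (suc k)) * (pow d k * d)
      ≈⟨ expand _ _ _ _ _ _ ⟩
    (A (suc (suc k)) * (pow d k * d) - c * A 0) + (A (suc k) * pow d k - (c * d) * (A (suc k) * pow d k))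
      ≈⟨ +-congˡ (+-congˡ (-‿cong (trans (*-congʳ cd≈1) (*-identityˡ _)))) ⟩
    (A (suc (suc k)) * (pow d k * d) - c * A 0) + (A (suc k) * pow d k - A (suc k) * pow d k)
      ≈⟨ trans (+-congˡ (-‿inverseʳ _)) (+-identityʳ _) ⟩
    A (suc (suc k)) * (pow d k * d) - c * A 0  ∎
    where
    expand : ∀ X Y D P c d → (X * D - c * P) + (Y - c * X) * (D * d)
                           ≈ (Y * (D * d) - c * P) + (X * D - (c * d) * (X * D))
    expand = solve 6 (λ X Y D P c d → (X :* D :- c :* P) :+ (Y :- c :* X) :* (D :* d)
                        := (Y :* (D :* d) :- c :* P) :+ (X :* D :- (c :* d) :* (X :* D))) refl

  telescope-scaled : ∀ (A T : ℕ → Carrier) {c d} e → c * d ≈ 1# →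
                     (∀ j → e * T j ≈ A (suc j) - c * A j) →
                     ∀ k → e * sumTo k (λ j → T j * pow d j) ≈ A (suc k) * pow d k - c * A 0
  telescope-scaled A T {c} {d} e cd≈1 eT≈ k = begin
    e * sumTo k (λ j → T j * pow d j)    ≈⟨ sumTo-*ˡ k e _ ⟩
    sumTo k (λ j → e * (T j * pow d j))  ≈⟨ sumTo-cong k (λ j → sym (*-assoc e _ _)) ⟩
    sumTo k (λ j → (e * T j) * pow d j)  ≈⟨ telescope A (λ j → e * T j) cd≈1 eT≈ k ⟩
    A (suc k) * pow d k - c * A 0        ∎

  module _ (p q : Carrier) (q≠0 : ¬ (q ≈ 0#)) where

    Recurrence : (ℤ → Carrier) → Set ℓ
    Recurrence f = ∀ n → f (ℤ.suc (ℤ.suc n)) ≈ p * f (ℤ.suc n) - q * f n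

    recurrence-backward : ∀ {f} → Recurrence f →
                          ∀ n → q * f n ≈ p * f (ℤ.suc n) - f (ℤ.suc (ℤ.suc n))
    recurrence-backward {f} rec n = sym (begin
      p * f (ℤ.suc n) - f (ℤ.suc (ℤ.suc n))          ≈⟨ +-congˡ (-‿cong (rec n)) ⟩
      p * f (ℤ.suc n) - (p * f (ℤ.suc n) - q * f n)  ≈⟨ x-[x-y]≈y _ _ ⟩
      q * f n                                        ∎)

    solved-backward : ∀ x y → y ≈ p * x - q * ((p * x - y) * inv q q≠0)
    solved-backward x y = sym (begin
      p * x - q * ((p * x - y) * inv q q≠0)  ≈⟨ reassociate p x y q _ ⟩
      p * x - (p * x - y) * (q * inv q q≠0)  ≈⟨ +-congˡ (-‿cong (*-congˡ (inv-r q q≠0))) ⟩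
      p * x - (p * x - y) * 1#               ≈⟨ +-congˡ (-‿cong (*-identityʳ _)) ⟩
      p * x - (p * x - y)                    ≈⟨ x-[x-y]≈y _ _ ⟩
      y                                      ∎)
      where
      reassociate : ∀ p x y q i → p * x - q * ((p * x - y) * i) ≈ p * x - (p * x - y) * (q * i)
      reassociate = solve 5 (λ p x y q i →
        p :* x :- q :* ((p :* x :- y) :* i) := p :* x :- (p :* x :- y) :* (q :* i)) refl

    -- The clauses follow how ℤ.suc computes on negative integers.
    w-recurrence : ∀ a b → Recurrence (w a b p q q≠0)
    w-recurrence a b (+ n)              = refl
    w-recurrence a b -[1+ 0 ]           = solved-backward _ _
    w-recurrence a b -[1+ 1 ]           = solved-backward _ _
    w-recurrence a b -[1+ suc (suc n) ] = solved-backward _ _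

    recurrence-shift : ∀ {f} → Recurrence f → ∀ s → Recurrence (λ i → f (i ℤ.+ s))
    recurrence-shift {f} rec s n = begin
      f (ℤ.suc (ℤ.suc n) ℤ.+ s)                               ≡⟨ P.cong f (suc-suc-+ n s) ⟩
      f (ℤ.suc (ℤ.suc (n ℤ.+ s)))                             ≈⟨ rec (n ℤ.+ s) ⟩
      p * f (ℤ.suc (n ℤ.+ s)) - q * f (n ℤ.+ s)               ≡⟨ P.cong (λ i → p * f i - q * f (n ℤ.+ s)) (P.sym (suc-+ n s)) ⟩
      p * f (ℤ.suc n ℤ.+ s) - q * f (n ℤ.+ s)                 ∎
      where
      suc-suc-+ : ∀ n s → 1ℤ ℤ.+ (1ℤ ℤ.+ n) ℤ.+ s ≡ 1ℤ ℤ.+ (1ℤ ℤ.+ (n ℤ.+ s))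
      suc-suc-+ = solve-∀
      suc-+ : ∀ n s → 1ℤ ℤ.+ n ℤ.+ s ≡ 1ℤ ℤ.+ (n ℤ.+ s)
      suc-+ = solve-∀

    recurrence-combination : ∀ {f g} → Recurrence f → Recurrence g →
                             ∀ α β → Recurrence (λ i → α * f i - β * g i)
    recurrence-combination {f} {g} recf recg α β n = begin
      α * f (ℤ.suc (ℤ.suc n)) - β * g (ℤ.suc (ℤ.suc n))
        ≈⟨ +-cong (*-congˡ (recf n)) (-‿cong (*-congˡ (recg n))) ⟩
      α * (p * f (ℤ.suc n) - q * f n) - β * (p * g (ℤ.suc n) - q * g n)
        ≈⟨ regroup _ _ _ _ _ _ _ _ ⟩
      p * (α * f (ℤ.suc n) - β * g (ℤ.suc n)) - q * (α * f n - β * g n)  ∎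
      where
      regroup : ∀ α β p q f₁ f₀ g₁ g₀ →
                α * (p * f₁ - q * f₀) - β * (p * g₁ - q * g₀)
                ≈ p * (α * f₁ - β * g₁) - q * (α * f₀ - β * g₀)
      regroup = solve 8 (λ α β p q f₁ f₀ g₁ g₀ →
        α :* (p :* f₁ :- q :* f₀) :- β :* (p :* g₁ :- q :* g₀)
        := p :* (α :* f₁ :- β :* g₁) :- q :* (α :* f₀ :- β :* g₀)) refl

    recurrence-unique : ∀ {f g} → Recurrence f → Recurrence g →
                        f (+ 0) ≈ g (+ 0) → f (+ 1) ≈ g (+ 1) → ∀ n → f n ≈ g n
    recurrence-unique {f} {g} recf recg f₀≈g₀ f₁≈g₁ = agree
      where
      forward : ∀ {n} → f n ≈ g n → f (ℤ.suc n) ≈ g (ℤ.suc n) →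
                f (ℤ.suc (ℤ.suc n)) ≈ g (ℤ.suc (ℤ.suc n))
      forward {n} eq₀ eq₁ = trans (recf n)
        (trans (+-cong (*-congˡ eq₁) (-‿cong (*-congˡ eq₀))) (sym (recg n)))

      backward : ∀ {n} → f (ℤ.suc n) ≈ g (ℤ.suc n) → f (ℤ.suc (ℤ.suc n)) ≈ g (ℤ.suc (ℤ.suc n)) →
                 f n ≈ g n
      backward {n} eq₁ eq₂ = *-cancelˡ-≉0 q≠0 (trans (recurrence-backward recf n)
        (trans (+-cong (*-congˡ eq₁) (-‿cong eq₂)) (sym (recurrence-backward recg n))))

      upward : ∀ n → f (+ n) ≈ g (+ n) × f (+ suc n) ≈ g (+ suc n)
      upward zero    = f₀≈g₀ , f₁≈g₁
      upward (suc n) with upward n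
      ... | eq₀ , eq₁ = eq₁ , forward eq₀ eq₁

      downward : ∀ n → f -[1+ n ] ≈ g -[1+ n ] × f (ℤ.suc -[1+ n ]) ≈ g (ℤ.suc -[1+ n ])
      downward zero    = backward f₀≈g₀ f₁≈g₁ , f₀≈g₀
      downward (suc n) with downward n
      ... | eq₁ , eq₂ = backward eq₁ eq₂ , eq₁

      agree : ∀ n → f n ≈ g n
      agree (+ n)    = proj₁ (upward n)
      agree -[1+ n ] = proj₁ (downward n)

    module _ (a b : Carrier) where
      private
        W U : ℤ → Carrier
        W = w a b p q q≠0
        U = u p q q≠0

        W-cong : ∀ {i j} → i ≡ j → W i ≈ W j
        W-cong i≡j = reflexive (P.cong W i≡j)

      u₋₁≈0 : U -[1+ 0 ] ≈ 0#
      u₋₁≈0 = begin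
        (p * 1# - p) * inv q q≠0  ≈⟨ *-congʳ (trans (+-congʳ (*-identityʳ p)) (-‿inverseʳ p)) ⟩
        0# * inv q q≠0            ≈⟨ zeroˡ _ ⟩
        0#                        ∎

      addition-law : ∀ n r → W (r ℤ.+ n) ≈ W n * U r - q * W (n ℤ.- 1ℤ) * U (r ℤ.- 1ℤ)
      addition-law n = recurrence-unique
        (recurrence-shift (w-recurrence a b) n)
        (recurrence-combination (w-recurrence 1# p)
          (recurrence-shift (w-recurrence 1# p) (ℤ.- 1ℤ)) (W n) (q * W (n ℤ.- 1ℤ)))
        at-0 at-1
        where
        at-0 : W (+ 0 ℤ.+ n) ≈ W n * 1# - q * W (n ℤ.- 1ℤ) * U -[1+ 0 ]
        at-0 = sym (begin
          W n * 1# - q * W (n ℤ.- 1ℤ) * U -[1+ 0 ]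
            ≈⟨ +-cong (*-identityʳ _) (-‿cong (trans (*-congˡ u₋₁≈0) (zeroʳ _))) ⟩
          W n - 0#                                    ≈⟨ trans (+-congˡ -0#≈0#) (+-identityʳ _) ⟩
          W n                                         ≈⟨ W-cong (P.sym (ℤP.+-identityˡ n)) ⟩
          W (+ 0 ℤ.+ n)                               ∎)
        at-1 : W (ℤ.suc n) ≈ W n * p - q * W (n ℤ.- 1ℤ) * 1#
        at-1 = begin
          W (ℤ.suc n)                                        ≈⟨ W-cong (P.sym (suc-suc-pred n)) ⟩
          W (ℤ.suc (ℤ.suc (n ℤ.- 1ℤ)))                       ≈⟨ w-recurrence a b (n ℤ.- 1ℤ) ⟩
          p * W (ℤ.suc (n ℤ.- 1ℤ)) - q * W (n ℤ.- 1ℤ)        ≈⟨ +-congʳ (*-congˡ (W-cong (suc-pred n))) ⟩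
          p * W n - q * W (n ℤ.- 1ℤ)                         ≈⟨ +-cong (*-comm p _) (-‿cong (sym (*-identityʳ _))) ⟩
          W n * p - q * W (n ℤ.- 1ℤ) * 1#                    ∎
          where
          suc-pred : ∀ n → 1ℤ ℤ.+ (n ℤ.- 1ℤ) ≡ n
          suc-pred = solve-∀
          suc-suc-pred : ∀ n → 1ℤ ℤ.+ (1ℤ ℤ.+ (n ℤ.- 1ℤ)) ≡ 1ℤ ℤ.+ n
          suc-suc-pred = solve-∀

      addition-law′ : ∀ n r {i n₋ r₋} → i ≡ r ℤ.+ n → n₋ ≡ n ℤ.- 1ℤ → r₋ ≡ r ℤ.- 1ℤ →
                      W i ≈ W n * U r - q * W n₋ * U r₋
      addition-law′ n r P.refl P.refl P.refl = addition-law n r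

      module _ (k : ℕ) (m : ℤ) where

        identity1 : Identity1 a b p q q≠0 k m
        identity1 r _ c≉0 = begin
          q * pow c k * U (r ℤ.- 1ℤ) * S
            ≈⟨ regroup q (pow c k) (U (r ℤ.- 1ℤ)) S ⟩
          - (pow c k * ((- (q * U (r ℤ.- 1ℤ))) * S))
            ≈⟨ -‿cong (*-congˡ (telescope-scaled A _ _ (inv-r c c≉0) step k)) ⟩
          - (pow c k * (A (suc k) * pow d k - c * A 0))
            ≈⟨ expand _ _ _ _ _ ⟩
          (pow c k * c) * A 0 - (pow c k * pow d k) * A (suc k)
            ≈⟨ +-congʳ (*-congˡ (W-cong (first m (+ k) r))) ⟩
          pow c (suc k) * W (m ℤ.- + k ℤ.* r ℤ.- r) - (pow c k * pow d k) * A (suc k)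
            ≈⟨ +-congˡ (-‿cong (trans (*-congʳ (pow-inverse (inv-r c c≉0) k)) (*-identityˡ _))) ⟩
          pow c (suc k) * W (m ℤ.- + k ℤ.* r ℤ.- r) - A (suc k)
            ≈⟨ +-congˡ (-‿cong (W-cong (last m (+ k) r))) ⟩
          pow c (suc k) * W (m ℤ.- + k ℤ.* r ℤ.- r) - W m  ∎
          where
          c d : Carrier
          c = U r
          d = inv c c≉0
          n x : ℤ → ℤ
          n j = m ℤ.- + k ℤ.* r ℤ.- r ℤ.+ r ℤ.* j
          x j = m ℤ.- + k ℤ.* r ℤ.- r ℤ.- 1ℤ ℤ.+ r ℤ.* j
          A : ℕ → Carrier
          A j = W (n (+ j))
          S : Carrier
          S = sumTo k (λ j → W (x (+ j)) * pow d j)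

          next : ∀ m k r j → m ℤ.- k ℤ.* r ℤ.- r ℤ.+ r ℤ.* (1ℤ ℤ.+ j)
                             ≡ r ℤ.+ (m ℤ.- k ℤ.* r ℤ.- r ℤ.+ r ℤ.* j)
          next = solve-∀
          previous : ∀ m k r j → m ℤ.- k ℤ.* r ℤ.- r ℤ.- 1ℤ ℤ.+ r ℤ.* j
                                 ≡ m ℤ.- k ℤ.* r ℤ.- r ℤ.+ r ℤ.* j ℤ.- 1ℤ
          previous = solve-∀
          first : ∀ m k r → m ℤ.- k ℤ.* r ℤ.- r ℤ.+ r ℤ.* + 0 ≡ m ℤ.- k ℤ.* r ℤ.- r
          first = solve-∀
          last : ∀ m k r → m ℤ.- k ℤ.* r ℤ.- r ℤ.+ r ℤ.* (1ℤ ℤ.+ k) ≡ m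
          last = solve-∀

          regroup : ∀ q P U S → q * P * U * S ≈ - (P * ((- (q * U)) * S))
          regroup = solve 4 (λ q P U S → q :* P :* U :* S := :- (P :* ((:- (q :* U)) :* S))) refl
          expand : ∀ P A D c A₀ → - (P * (A * D - c * A₀)) ≈ (P * c) * A₀ - (P * D) * A
          expand = solve 5 (λ P A D c A₀ →
            :- (P :* (A :* D :- c :* A₀)) := (P :* c) :* A₀ :- (P :* D) :* A) refl
          cancel : ∀ A c q Y U → (A * c - q * Y * U) - c * A ≈ (- (q * U)) * Y
          cancel = solve 5 (λ A c q Y U → (A :* c :- q :* Y :* U) :- c :* A := (:- (q :* U)) :* Y) refl

          step : ∀ j → (- (q * U (r ℤ.- 1ℤ))) * W (x (+ j)) ≈ A (suc j) - c * A j
          step j = sym (begin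
            A (suc j) - c * A j
              ≈⟨ +-congʳ (addition-law′ (n (+ j)) r (next m (+ k) r (+ j)) (previous m (+ k) r (+ j)) P.refl) ⟩
            (A j * c - q * W (x (+ j)) * U (r ℤ.- 1ℤ)) - c * A j
              ≈⟨ cancel _ _ q _ _ ⟩
            (- (q * U (r ℤ.- 1ℤ))) * W (x (+ j))  ∎)

        identity2 : Identity2 a b p q q≠0 k m
        identity2 r _ c≉0 = begin
          U (r ℤ.- 1ℤ) * sumTo k (λ j → W (y (+ j)) * pow d j)
            ≈⟨ telescope-scaled A _ _ (inv-r c c≉0) step k ⟩
          A (suc k) * pow d k - c * A 0
            ≈⟨ minus-negate _ q _ _ ⟩
          A (suc k) * pow d k + q * U (r ℤ.- + 2) * A 0
            ≈⟨ +-cong (*-congʳ (W-cong (last m (+ k) r))) (*-congˡ (W-cong (first m (+ k) r))) ⟩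
          W m * pow d k + q * U (r ℤ.- + 2) * W (m ℤ.- (+ k ℤ.+ 1ℤ) ℤ.* r)  ∎
          where
          c d : Carrier
          c = - (q * U (r ℤ.- + 2))
          d = inv c c≉0
          n y : ℤ → ℤ
          n j = m ℤ.- + k ℤ.* r ℤ.- r ℤ.+ r ℤ.* j
          y j = m ℤ.- + k ℤ.* r ℤ.- r ℤ.+ 1ℤ ℤ.+ r ℤ.* j
          A : ℕ → Carrier
          A j = W (n (+ j))

          next : ∀ m k r j → m ℤ.- k ℤ.* r ℤ.- r ℤ.+ r ℤ.* (1ℤ ℤ.+ j)
                             ≡ (r ℤ.- 1ℤ) ℤ.+ (m ℤ.- k ℤ.* r ℤ.- r ℤ.+ 1ℤ ℤ.+ r ℤ.* j)
          next = solve-∀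
          previous : ∀ m k r j → m ℤ.- k ℤ.* r ℤ.- r ℤ.+ r ℤ.* j
                                 ≡ m ℤ.- k ℤ.* r ℤ.- r ℤ.+ 1ℤ ℤ.+ r ℤ.* j ℤ.- 1ℤ
          previous = solve-∀
          two-back : ∀ r → r ℤ.- + 2 ≡ r ℤ.- 1ℤ ℤ.- 1ℤ
          two-back = solve-∀
          first : ∀ m k r → m ℤ.- k ℤ.* r ℤ.- r ℤ.+ r ℤ.* + 0 ≡ m ℤ.- (k ℤ.+ 1ℤ) ℤ.* r
          first = solve-∀
          last : ∀ m k r → m ℤ.- k ℤ.* r ℤ.- r ℤ.+ r ℤ.* (1ℤ ℤ.+ k) ≡ m
          last = solve-∀

          minus-negate : ∀ X q U A → X - (- (q * U)) * A ≈ X + q * U * A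
          minus-negate = solve 4 (λ X q U A → X :- (:- (q :* U)) :* A := X :+ q :* U :* A) refl
          cancel : ∀ Y U′ q A U″ → (Y * U′ - q * A * U″) - (- (q * U″)) * A ≈ U′ * Y
          cancel = solve 5 (λ Y U′ q A U″ →
            (Y :* U′ :- q :* A :* U″) :- (:- (q :* U″)) :* A := U′ :* Y) refl

          step : ∀ j → U (r ℤ.- 1ℤ) * W (y (+ j)) ≈ A (suc j) - c * A j
          step j = sym (begin
            A (suc j) - c * A j
              ≈⟨ +-congʳ (addition-law′ (y (+ j)) (r ℤ.- 1ℤ)
                   (next m (+ k) r (+ j)) (previous m (+ k) r (+ j)) (two-back r)) ⟩
            (W (y (+ j)) * U (r ℤ.- 1ℤ) - q * A j * U (r ℤ.- + 2)) - c * A j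
              ≈⟨ cancel _ _ q _ _ ⟩
            U (r ℤ.- 1ℤ) * W (y (+ j))  ∎)

        identity3 : Identity3 a b p q q≠0 k m
        identity3 r _ R≉0 c≉0 = begin
          sumTo k (λ j → W (m ℤ.- + k ℤ.+ r ℤ.+ + j) * pow d j)
            ≈⟨ telescope B _ (inv-r c c≉0) step k ⟩
          R * W (z (+ suc k)) * pow d k - c * B 0
            ≈⟨ +-cong (*-congʳ (*-congˡ (W-cong (last m (+ k)))))
                      (-‿cong (trans (swap c R _) (*-cong Rc≈qU′ (W-cong (first m (+ k)))))) ⟩
          R * W m * pow d k - q * U (r ℤ.- 1ℤ) * W (m ℤ.- + k ℤ.- 1ℤ)  ∎
          where
          R c d : Carrier
          R = U r
          c = q * U (r ℤ.- 1ℤ) * inv R R≉0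
          d = inv c c≉0
          z : ℤ → ℤ
          z j = m ℤ.- + k ℤ.- 1ℤ ℤ.+ j
          B : ℕ → Carrier
          B j = R * W (z (+ j))

          next : ∀ m k r j → m ℤ.- k ℤ.+ r ℤ.+ j ≡ r ℤ.+ (m ℤ.- k ℤ.- 1ℤ ℤ.+ (1ℤ ℤ.+ j))
          next = solve-∀
          previous : ∀ m k j → m ℤ.- k ℤ.- 1ℤ ℤ.+ j ≡ m ℤ.- k ℤ.- 1ℤ ℤ.+ (1ℤ ℤ.+ j) ℤ.- 1ℤ
          previous = solve-∀
          first : ∀ m k → m ℤ.- k ℤ.- 1ℤ ℤ.+ + 0 ≡ m ℤ.- k ℤ.- 1ℤ
          first = solve-∀
          last : ∀ m k → m ℤ.- k ℤ.- 1ℤ ℤ.+ (1ℤ ℤ.+ k) ≡ m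
          last = solve-∀

          swap : ∀ c R X → c * (R * X) ≈ (R * c) * X
          swap = solve 3 (λ c R X → c :* (R :* X) := (R :* c) :* X) refl
          reorder : ∀ X′ R q X U → X′ * R - q * X * U ≈ R * X′ - (q * U) * X
          reorder = solve 5 (λ X′ R q X U → X′ :* R :- q :* X :* U := R :* X′ :- (q :* U) :* X) refl
          pull : ∀ R X i → R * (X * i) ≈ X * (R * i)
          pull = solve 3 (λ R X i → R :* (X :* i) := X :* (R :* i)) refl

          Rc≈qU′ : R * c ≈ q * U (r ℤ.- 1ℤ)
          Rc≈qU′ = begin
            R * (q * U (r ℤ.- 1ℤ) * inv R R≉0)  ≈⟨ pull R _ _ ⟩
            q * U (r ℤ.- 1ℤ) * (R * inv R R≉0)  ≈⟨ *-congˡ (inv-r R R≉0) ⟩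
            q * U (r ℤ.- 1ℤ) * 1#               ≈⟨ *-identityʳ _ ⟩
            q * U (r ℤ.- 1ℤ)                    ∎

          step : ∀ j → W (m ℤ.- + k ℤ.+ r ℤ.+ + j) ≈ B (suc j) - c * B j
          step j = begin
            W (m ℤ.- + k ℤ.+ r ℤ.+ + j)
              ≈⟨ addition-law′ (z (+ suc j)) r (next m (+ k) r (+ j)) (previous m (+ k) (+ j)) P.refl ⟩
            W (z (+ suc j)) * R - q * W (z (+ j)) * U (r ℤ.- 1ℤ)
              ≈⟨ reorder _ R q _ _ ⟩
            R * W (z (+ suc j)) - (q * U (r ℤ.- 1ℤ)) * W (z (+ j))
              ≈⟨ +-congˡ (-‿cong (trans (*-congʳ (sym Rc≈qU′)) (sym (swap c R _)))) ⟩
            R * W (z (+ suc j)) - c * (R * W (z (+ j)))  ∎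

theorem5 : {c ℓ : Level} (F : Field c ℓ) (a b p q : Field.Carrier F) →
           ¬ (Field._≈_ F p (Field.0# F)) → (q≠0 : ¬ (Field._≈_ F q (Field.0# F))) →
           (k : ℕ) (m : ℤ) →
           Sequences.Identity1 F a b p q q≠0 k m
           × Sequences.Identity2 F a b p q q≠0 k m
           × Sequences.Identity3 F a b p q q≠0 k m
theorem5 F a b p q _ q≠0 k m =
  identity1 F p q q≠0 a b k m , identity2 F p q q≠0 a b k m , identity3 F p q q≠0 a b k m
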